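{- Fix a prime number $p$, positive integers $w$ and $t$, a real number $c > 1/2$, and a set $X \subseteq \mathbb{N}$. Suppose that $\#V_{p^w,0,m}(X) \geq c\, m\, \varphi(p^w)$ for some positive integer $m > t/(2c-1)$. Then $R(X)$ has nonempty intersection with every set belonging to $V_{p^w,0,t}$.
   Context: $\mathbb{N}$ is the set of positive integers and $R(X) := \{a/b : a,b \in X\} \subseteq \mathbb{Q}$, viewed inside $\mathbb{Q}_p$. $\nu_p$ is the $p$-adic valuation and $\varphi$ is Euler's totient function. The group $(\mathbb{Z}/p^w\mathbb{Z})^*$ is identified with $\{a \in \{1,\ldots,p^w\} : p \nmid a\}$. For $a \in (\mathbb{Z}/p^w\mathbb{Z})^*$, let $(a)_{p^w} := \{x \in \mathbb{Q}_p^* : x/p^{\nu_p(x)} \equiv a \pmod{p^w}\}$. For integers $t' \leq m'$, let $V_{p^w,t',m'} := \{(a)_{p^w} \cap \nu_p^{ -1}(s) : a \in (\mathbb{Z}/p^w\mathbb{Z})^*,\ s \in \mathbb{Z},\ t' \leq s < m'\}$, and for $X \subseteq \mathbb{N}$ let $V_{p^w,t',m'}(X) := \{I \in V_{p^w,t',m'} : X \cap I \neq \varnothing\}$.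
   Formalization: The number $c > 1/2$ is taken in the rationals instead of the reals. -}

module Defs where

open import Data.Nat using (ℕ; zero; suc; _+_; _*_; _^_; _≤_; _<_; _%_; NonZero)
open import Data.Nat.Divisibility using (_∣_)
open import Data.Nat.Coprimality using (coprime?)
open import Data.List using (List; length; filter; upTo; map)
open import Data.Integer using (+_)
open import Data.Rational using (ℚ; _/_)
open import Data.Product using (Σ; _×_; ∃)
open import Relation.Binary.PropositionalEquality using (_≡_)
open import Relation.Nullary using (¬_)

φ : ℕ → ℕ
φ n = length (filter (λ a → coprime? a n) (map suc (upTo n)))

ℕ→ℚ : ℕ → ℚ
ℕ→ℚ n = (+ n) / 1

-- a is an element of (ℤ/p^w ℤ)^* under the identification {a ∈ {1,…,p^w} : p ∤ a}
IsUnitRep : (p w a : ℕ) → Set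
IsUnitRep p w a = (1 ≤ a) × (a ≤ p ^ w) × ¬ (p ∣ a)

-- x ∈ (a)_{p^w} ∩ ν_p^{-1}(s) for a positive integer x (viewed in ℚ_p):
-- x = p^s · u with p ∤ u (so ν_p(x) = s, x/p^{ν_p(x)} = u) and u ≡ a (mod p^w).
InCell : (p w a s x : ℕ) → .{{_ : NonZero (p ^ w)}} → Set
InCell p w a s x = Σ ℕ λ u → (x ≡ p ^ s * u) × ¬ (p ∣ u) × (u % (p ^ w) ≡ a % (p ^ w))

-- x / y ∈ (a)_{p^w} ∩ ν_p^{-1}(s) (s ≥ 0) for positive integers x, y (viewed in ℚ_p):
-- x = p^e · u, y = p^f · v with p ∤ u, p ∤ v, so ν_p(x/y) = e - f and the unit
-- part of x/y is u/v; the conditions are e = s + f and u/v ≡ a (mod p^w),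
-- i.e. u ≡ a·v (mod p^w) (v is a p-adic unit).
RatioInCell : (p w a s x y : ℕ) → .{{_ : NonZero (p ^ w)}} → Set
RatioInCell p w a s x y =
  Σ ℕ λ e → Σ ℕ λ f → Σ ℕ λ u → Σ ℕ λ v →
    (x ≡ p ^ e * u) × (y ≡ p ^ f * v) × ¬ (p ∣ u) × ¬ (p ∣ v) ×
    (e ≡ s + f) × (u % (p ^ w) ≡ (a * v) % (p ^ w))

{-# OPTIONS --safe #-}
module Submission where

-- Write N = p ^ w and call (b , e) with b a unit mod N an occupied cell if X meets (b)_N ∩ ν_p⁻¹(e).
-- The k occupied cells of depth < m and their translates (a b mod N , s + e) are two k-element
-- sets of cells of depth < s + m.  There are only φ(N)(s + m) ≤ φ(N)(t + m) < 2cmφ(N) ≤ 2k such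
-- cells, so the two sets meet: x in cell (b , e) and y in cell (b′ , f) with b ≡ a b′ and e = s + f,
-- whence x / y ∈ (a)_N ∩ ν_p⁻¹(s).

open import Defs
open import Data.Nat using (ℕ; _^_; _<_; _≤_; NonZero)
open import Data.Nat.Primality using (Prime)
open import Data.Fin using (Fin)
open import Data.Product using (Σ; _×_; _,_; proj₁; proj₂)
open import Function.Definitions using (Injective)
open import Relation.Binary.PropositionalEquality using (_≡_)

-- A separate module, so that ℕ's _+_ and _*_ do not clash with ℚ's, which the statement uses.
module ResidueCells where
  open import Data.Nat using (suc; zero; _+_; _*_; _∸_; _/_; _%_)
  open import Data.Nat.Properties
    using (<⇒≱; ≤-antisym; ≤-total; <-≤-trans; m≤n+m; n≢0⇒n>0; +-monoʳ-<; +-cancelˡ-≡; *-monoʳ-≤;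
           *-distribˡ-∸; *-distribʳ-∸; [m+n]∸[m+o]≡n∸o; ∸-monoʳ-<; m∸n≡0⇒m≤n)
  open import Data.Nat.DivMod using (m≡m%n+[m/n]*n; m%n%n≡m%n; m%n≤n; %-distribˡ-*)
  open import Data.Nat.Divisibility using (_∣_; divides; _∣0; ∣1⇒≡1; ∣-trans; m∣m*n; >⇒∤; ∣n∣m%n⇒∣m)
  open import Data.Nat.Coprimality as Coprimality using (Coprime; coprime?; coprime-divisor)
  open import Data.Nat.Primality using (prime⇒irreducible; euclidsLemma)
  open import Data.Fin using (combine; fromℕ<; splitAt)
  open import Data.Fin.Properties using (any?; _≟_; injective⇒≤; combine-injective; fromℕ<-injective; +↔⊎)
  open import Data.List using (List; filter; map; upTo)
  open import Data.List.Membership.Propositional using (_∈_)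
  open import Data.List.Membership.Propositional.Properties using (∈-filter⁺; ∈-map⁺; ∈-upTo⁺)
  open import Data.List.Membership.Setoid.Properties using (index-injective)
  open import Data.List.Relation.Unary.Any using (index)
  open import Data.Product using (∃₂)
  open import Data.Product.Properties using (×-≡,≡→≡)
  open import Data.Sum using (inj₁; inj₂; [_,_]′)
  open import Function using (_∘_; Injection)
  open import Function.Properties.Inverse using (Inverse⇒Injection)
  open import Relation.Nullary using (¬_; yes; no; contradiction)
  open import Relation.Binary.PropositionalEquality
    using (_≢_; refl; sym; cong; cong₂; subst; setoid; module ≡-Reasoning)

  injections-meet : ∀ {k n} (f g : Fin k → Fin n) → Injective _≡_ _≡_ f → Injective _≡_ _≡_ g →
    n < k + k → ∃₂ λ i j → f i ≡ g j
  injections-meet {k} f g f-inj g-inj n<k+k with any? (λ i → any? (λ j → f i ≟ g j))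
  ... | yes (i , j , fi≡gj) = i , j , fi≡gj
  ... | no disjoint = contradiction (injective⇒≤ (split-injective ∘ joint-injective)) (<⇒≱ n<k+k)
    where
    split-injective : Injective _≡_ _≡_ (splitAt k {k})
    split-injective = Injection.injective (Inverse⇒Injection +↔⊎)
    joint-injective : Injective _≡_ _≡_ [ f , g ]′
    joint-injective {inj₁ i} {inj₁ j} e = cong inj₁ (f-inj e)
    joint-injective {inj₁ i} {inj₂ j} e = contradiction (i , j , e) disjoint
    joint-injective {inj₂ i} {inj₁ j} e = contradiction (j , i , sym e) disjoint
    joint-injective {inj₂ i} {inj₂ j} e = cong inj₂ (g-inj e)

  m∣m^n : ∀ {m n} → 1 ≤ n → m ∣ m ^ n
  m∣m^n {m} {suc n} _ = m∣m*n (m ^ n)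

  prime∤⇒coprime : ∀ {p a} → Prime p → ¬ p ∣ a → Coprime a p
  prime∤⇒coprime pp p∤a (d∣a , d∣p) with prime⇒irreducible pp d∣p
  ... | inj₁ d≡1 = d≡1
  ... | inj₂ refl = contradiction d∣a p∤a

  coprime-^ʳ : ∀ {a p} → Coprime a p → ∀ w → Coprime a (p ^ w)
  coprime-^ʳ a⊥p zero (_ , d∣1) = ∣1⇒≡1 d∣1
  coprime-^ʳ {a} {p} a⊥p (suc w) {d} (d∣a , d∣p*pʷ) = coprime-^ʳ a⊥p w (d∣a , coprime-divisor d⊥p d∣p*pʷ)
    where
    d⊥p : Coprime d p
    d⊥p (e∣d , e∣p) = a⊥p (∣-trans e∣d d∣a , e∣p)

  %≡%⇒∣∸ : ∀ {m o} n .{{_ : NonZero n}} → m % n ≡ o % n → m ≤ o → n ∣ o ∸ m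
  %≡%⇒∣∸ {m} {o} n m%n≡o%n _ = divides (o / n ∸ m / n) (begin
    o ∸ m                                     ≡⟨ cong₂ _∸_ (m≡m%n+[m/n]*n o n) (m≡m%n+[m/n]*n m n) ⟩
    (o % n + o / n * n) ∸ (m % n + m / n * n) ≡⟨ cong (λ r → (o % n + o / n * n) ∸ (r + m / n * n)) m%n≡o%n ⟩
    (o % n + o / n * n) ∸ (o % n + m / n * n) ≡⟨ [m+n]∸[m+o]≡n∸o (o % n) _ _ ⟩
    o / n * n ∸ m / n * n                     ≡⟨ *-distribʳ-∸ n (o / n) (m / n) ⟨
    (o / n ∸ m / n) * n                       ∎)
    where open ≡-Reasoning

  *-cancelˡ-%-≤ : ∀ {a b c n} .{{_ : NonZero n}} → Coprime a n → 1 ≤ b → b ≤ c → c ≤ n →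
    (a * b) % n ≡ (a * c) % n → b ≡ c
  *-cancelˡ-%-≤ {a} {b} {c} {n} a⊥n 1≤b b≤c c≤n ab≡ac = ≤-antisym b≤c (m∸n≡0⇒m≤n c∸b≡0)
    where
    n∣c∸b : n ∣ c ∸ b
    n∣c∸b = coprime-divisor (Coprimality.sym a⊥n)
      (subst (n ∣_) (sym (*-distribˡ-∸ a c b)) (%≡%⇒∣∸ n ab≡ac (*-monoʳ-≤ a b≤c)))
    c∸b<n : c ∸ b < n
    c∸b<n = <-≤-trans (∸-monoʳ-< 1≤b b≤c) c≤n
    c∸b≡0 : c ∸ b ≡ 0
    c∸b≡0 with c ∸ b | n∣c∸b | c∸b<n
    ... | zero  | _    | _   = refl
    ... | suc _ | n∣1+ | 1+<n = contradiction n∣1+ (>⇒∤ 1+<n)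

  *-cancelˡ-% : ∀ {a b c n} .{{_ : NonZero n}} → Coprime a n → 1 ≤ b → b ≤ n → 1 ≤ c → c ≤ n →
    (a * b) % n ≡ (a * c) % n → b ≡ c
  *-cancelˡ-% a⊥n 1≤b b≤n 1≤c c≤n ab≡ac with ≤-total _ _
  ... | inj₁ b≤c = *-cancelˡ-%-≤ a⊥n 1≤b b≤c c≤n ab≡ac
  ... | inj₂ c≤b = sym (*-cancelˡ-%-≤ a⊥n 1≤c c≤b b≤n (sym ab≡ac))

  coprimeResidues : ℕ → List ℕ
  coprimeResidues n = filter (λ a → coprime? a n) (map suc (upTo n))

  ∈-coprimeResidues : ∀ {a n} → 1 ≤ a → a ≤ n → Coprime a n → a ∈ coprimeResidues n
  ∈-coprimeResidues {suc a} {n} _ a<n a⊥n = ∈-filter⁺ (λ a → coprime? a n) (∈-map⁺ suc (∈-upTo⁺ a<n)) a⊥n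

  module Cells (p w : ℕ) (p-prime : Prime p) (1≤w : 1 ≤ w) .{{_ : NonZero (p ^ w)}} where

    N : ℕ
    N = p ^ w

    isUnitRep⇒coprime : ∀ {a} → IsUnitRep p w a → Coprime a N
    isUnitRep⇒coprime (_ , _ , p∤a) = coprime-^ʳ (prime∤⇒coprime p-prime p∤a) w

    *-%-isUnitRep : ∀ {a b} → IsUnitRep p w a → IsUnitRep p w b → IsUnitRep p w ((a * b) % N)
    *-%-isUnitRep {a} {b} (_ , _ , p∤a) (_ , _ , p∤b) = n≢0⇒n>0 ab%N≢0 , m%n≤n (a * b) N , p∤ab%N
      where
      p∤ab%N : ¬ p ∣ (a * b) % N
      p∤ab%N p∣ab%N with euclidsLemma a b p-prime (∣n∣m%n⇒∣m (m∣m^n 1≤w) p∣ab%N)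
      ... | inj₁ p∣a = p∤a p∣a
      ... | inj₂ p∣b = p∤b p∣b
      ab%N≢0 : (a * b) % N ≢ 0
      ab%N≢0 ab%N≡0 = p∤ab%N (subst (p ∣_) (sym ab%N≡0) (p ∣0))

    *-%-injectiveʳ : ∀ {a b c} → IsUnitRep p w a → IsUnitRep p w b → IsUnitRep p w c →
      (a * b) % N ≡ (a * c) % N → b ≡ c
    *-%-injectiveʳ ua (1≤b , b≤N , _) (1≤c , c≤N , _) = *-cancelˡ-% (isUnitRep⇒coprime ua) 1≤b b≤N 1≤c c≤N

    unit∈coprimeResidues : ∀ {a} → IsUnitRep p w a → a ∈ coprimeResidues N
    unit∈coprimeResidues ua@(1≤a , a≤N , _) = ∈-coprimeResidues 1≤a a≤N (isUnitRep⇒coprime ua)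

    unitIndex : ∀ {a} → IsUnitRep p w a → Fin (φ N)
    unitIndex ua = index (unit∈coprimeResidues ua)

    cellIndex : ∀ {a s B} → IsUnitRep p w a → s < B → Fin (φ N * B)
    cellIndex ua s<B = combine (unitIndex ua) (fromℕ< s<B)

    cellIndex-injective : ∀ {a s b t B} (ua : IsUnitRep p w a) (ub : IsUnitRep p w b)
      (s<B : s < B) (t<B : t < B) → cellIndex ua s<B ≡ cellIndex ub t<B → a ≡ b × s ≡ t
    cellIndex-injective {s = s} {t = t} ua ub s<B t<B e with combine-injective _ _ _ _ e
    ... | ia≡ib , s≡t = index-injective (setoid ℕ) (unit∈coprimeResidues ua) (unit∈coprimeResidues ub) ia≡ib
                      , fromℕ<-injective s t s<B t<B s≡t

    inCell⇒ratioInCell : ∀ {a s b e c f x y} → InCell p w b e x → InCell p w c f y →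
      b ≡ (a * c) % N → e ≡ s + f → RatioInCell p w a s x y
    inCell⇒ratioInCell {a} {s} {b} {e} {c} {f} (u , x≡pᵉu , p∤u , u≡b) (v , y≡pᶠv , p∤v , v≡c) b≡ac e≡s+f =
      e , f , u , v , x≡pᵉu , y≡pᶠv , p∤u , p∤v , e≡s+f , u≡av
      where
      open ≡-Reasoning
      u≡av : u % N ≡ (a * v) % N
      u≡av = begin
        u % N                   ≡⟨ u≡b ⟩
        b % N                   ≡⟨ cong (_% N) b≡ac ⟩
        (a * c) % N % N         ≡⟨ m%n%n≡m%n (a * c) N ⟩
        (a * c) % N             ≡⟨ %-distribˡ-* a c N ⟩
        (a % N * (c % N)) % N   ≡⟨ cong (λ r → (a % N * r) % N) v≡c ⟨
        (a % N * (v % N)) % N   ≡⟨ %-distribˡ-* a v N ⟨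
        (a * v) % N             ∎

    OccupiedCell : (X : ℕ → Set) (m : ℕ) → ℕ × ℕ → Set
    OccupiedCell X m (a , s) = IsUnitRep p w a × s < m × Σ ℕ λ x → X x × InCell p w a s x

    ratio-meets-cell : (X : ℕ → Set) {a s m k : ℕ} → IsUnitRep p w a → φ N * (s + m) < k + k →
      (cell : Fin k → ℕ × ℕ) → Injective _≡_ _≡_ cell → (∀ i → OccupiedCell X m (cell i)) →
      Σ ℕ λ x → Σ ℕ λ y → X x × X y × RatioInCell p w a s x y
    ratio-meets-cell X {a} {s} {m} ua few-cells cell cell-inj occupied =
      meet (injections-meet source target source-injective target-injective few-cells)
      where
      unit : ∀ i → IsUnitRep p w (proj₁ (cell i))
      unit i = proj₁ (occupied i)
      shallow : ∀ i → proj₂ (cell i) < m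
      shallow i = proj₁ (proj₂ (occupied i))

      source-depth : ∀ i → proj₂ (cell i) < s + m
      source-depth i = <-≤-trans (shallow i) (m≤n+m m s)
      target-unit : ∀ i → IsUnitRep p w ((a * proj₁ (cell i)) % N)
      target-unit i = *-%-isUnitRep ua (unit i)
      target-depth : ∀ i → s + proj₂ (cell i) < s + m
      target-depth i = +-monoʳ-< s (shallow i)

      source target : Fin _ → Fin (φ N * (s + m))
      source i = cellIndex (unit i) (source-depth i)
      target i = cellIndex (target-unit i) (target-depth i)

      source-injective : Injective _≡_ _≡_ source
      source-injective {i} {j} e
        with cellIndex-injective (unit i) (unit j) (source-depth i) (source-depth j) e
      ... | a≡ , s≡ = cell-inj (×-≡,≡→≡ (a≡ , s≡))

      target-injective : Injective _≡_ _≡_ target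
      target-injective {i} {j} e
        with cellIndex-injective (target-unit i) (target-unit j) (target-depth i) (target-depth j) e
      ... | aa≡ , ss≡ = cell-inj (×-≡,≡→≡ (*-%-injectiveʳ ua (unit i) (unit j) aa≡ , +-cancelˡ-≡ s _ _ ss≡))

      meet : ∃₂ (λ i j → source i ≡ target j) → Σ ℕ λ x → Σ ℕ λ y → X x × X y × RatioInCell p w a s x y
      meet (i , j , e) =
        let b≡ab′ , e≡s+f = cellIndex-injective (unit i) (target-unit j) (source-depth i) (target-depth j) e
            _ , _ , x , Xx , x∈ = occupied i
            _ , _ , y , Xy , y∈ = occupied j
        in x , y , Xx , Xy , inCell⇒ratioInCell {a = a} x∈ y∈ b≡ab′ e≡s+f

open ResidueCells using (module Cells)
open import Data.Rational using (ℚ; ½; 1ℚ; _+_; _*_; _-_) renaming (_<_ to _<ℚ_; _≤_ to _≤ℚ_)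
open import Data.Rational using (mkℚ; Positive; NonNegative; *≤*)
open import Data.Rational.Properties as ℚ using (normalize-coprime; drop-*<*)
open import Data.Rational.Solver using (module +-*-Solver)
import Data.Nat as ℕ
open import Data.Nat.Properties using (<⇒≤)
open import Data.Integer using (+_; +≤+)
open import Data.Integer.Properties using (*-identityʳ; pos-*; drop‿+<+)
open import Data.Nat.Coprimality as Coprimality using (1-coprimeTo)
open import Data.Fin.Properties using (nonZeroIndex)
open import Relation.Binary.PropositionalEquality using (refl; sym; trans; cong; subst₂)

ℕ→ℚ≡mkℚ : ∀ n → ℕ→ℚ n ≡ mkℚ (+ n) 0 (Coprimality.sym (1-coprimeTo n))
ℕ→ℚ≡mkℚ n = normalize-coprime (Coprimality.sym (1-coprimeTo n))

ℕ→ℚ-homo-+ : ∀ m n → ℕ→ℚ (m ℕ.+ n) ≡ ℕ→ℚ m + ℕ→ℚ n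
ℕ→ℚ-homo-+ m n rewrite ℕ→ℚ≡mkℚ m | ℕ→ℚ≡mkℚ n | *-identityʳ (+ m) | *-identityʳ (+ n) = refl

ℕ→ℚ-homo-* : ∀ m n → ℕ→ℚ (m ℕ.* n) ≡ ℕ→ℚ m * ℕ→ℚ n
ℕ→ℚ-homo-* m n rewrite ℕ→ℚ≡mkℚ m | ℕ→ℚ≡mkℚ n = cong (Data.Rational._/ 1) (pos-* m n)

ℕ→ℚ-mono-≤ : ∀ {m n} → m ℕ.≤ n → ℕ→ℚ m ≤ℚ ℕ→ℚ n
ℕ→ℚ-mono-≤ {m} {n} m≤n rewrite ℕ→ℚ≡mkℚ m | ℕ→ℚ≡mkℚ n =
  *≤* (subst₂ Data.Integer._≤_ (sym (*-identityʳ (+ m))) (sym (*-identityʳ (+ n))) (+≤+ m≤n))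

ℕ→ℚ-cancel-< : ∀ {m n} → ℕ→ℚ m <ℚ ℕ→ℚ n → m ℕ.< n
ℕ→ℚ-cancel-< {m} {n} m<n rewrite ℕ→ℚ≡mkℚ m | ℕ→ℚ≡mkℚ n with drop-*<* m<n
... | m*1<n*1 rewrite *-identityʳ (+ m) | *-identityʳ (+ n) = drop‿+<+ m*1<n*1

ℕ→ℚ-positive : ∀ n .{{_ : NonZero n}} → Positive (ℕ→ℚ n)
ℕ→ℚ-positive (ℕ.suc n) rewrite ℕ→ℚ≡mkℚ (ℕ.suc n) = _

f*[s+m]<k+k : ∀ (c : ℚ) f m t s k .{{_ : NonZero f}} → ℕ→ℚ t <ℚ (c + c - 1ℚ) * ℕ→ℚ m →
  c * ℕ→ℚ m * ℕ→ℚ f ≤ℚ ℕ→ℚ k → s ℕ.≤ t → f ℕ.* (s ℕ.+ m) ℕ.< k ℕ.+ k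
f*[s+m]<k+k c f m t s k t<[2c-1]m cmf≤k s≤t = ℕ→ℚ-cancel-< (begin-strict
  ℕ→ℚ (f ℕ.* (s ℕ.+ m))            ≡⟨ trans (ℕ→ℚ-homo-* f _) (cong (F *_) (ℕ→ℚ-homo-+ s m)) ⟩
  F * (S + M)                      ≡⟨ ℚ.*-distribˡ-+ F S M ⟩
  F * S + F * M                    ≤⟨ ℚ.+-monoˡ-≤ (F * M) (ℚ.*-monoˡ-≤-nonNeg F (ℕ→ℚ-mono-≤ s≤t)) ⟩
  F * T + F * M                    <⟨ ℚ.+-monoˡ-< (F * M) (ℚ.*-monoʳ-<-pos F t<[2c-1]m) ⟩
  F * ((c + c - 1ℚ) * M) + F * M   ≡⟨ solve 3 (λ c M F → F :* ((c :+ c :- con 1ℚ) :* M) :+ F :* M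
                                                       := c :* M :* F :+ c :* M :* F) refl c M F ⟩
  c * M * F + c * M * F            ≤⟨ ℚ.+-mono-≤ cmf≤k cmf≤k ⟩
  ℕ→ℚ k + ℕ→ℚ k                    ≡⟨ ℕ→ℚ-homo-+ k k ⟨
  ℕ→ℚ (k ℕ.+ k)                    ∎)
  where
  open ℚ.≤-Reasoning
  open +-*-Solver
  F M S T : ℚ
  F = ℕ→ℚ f
  M = ℕ→ℚ m
  S = ℕ→ℚ s
  T = ℕ→ℚ t
  instance
    F>0 : Positive F
    F>0 = ℕ→ℚ-positive f
    F≥0 : NonNegative F
    F≥0 = ℚ.pos⇒nonNeg F

lemma3p1 : (p w t : ℕ) → Prime p → 1 ≤ w → 1 ≤ t → .{{_ : NonZero (p ^ w)}} →
    (c : ℚ) → ½ <ℚ c →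
    (X : ℕ → Set) → (∀ x → X x → 1 ≤ x) →
    (Σ ℕ λ m → (1 ≤ m) × (ℕ→ℚ t <ℚ ((c + c) - 1ℚ) * ℕ→ℚ m) ×
      (Σ ℕ λ k → (c * ℕ→ℚ m * ℕ→ℚ (φ (p ^ w)) ≤ℚ ℕ→ℚ k) ×
        (Σ (Fin k → ℕ × ℕ) λ cell → Injective _≡_ _≡_ cell ×
          (∀ i → IsUnitRep p w (proj₁ (cell i)) × (proj₂ (cell i) < m) ×
            (Σ ℕ λ x → X x × InCell p w (proj₁ (cell i)) (proj₂ (cell i)) x))))) →
    ∀ a s → IsUnitRep p w a → s < t →
      Σ ℕ λ x → Σ ℕ λ y → X x × X y × RatioInCell p w a s x y
lemma3p1 p w t p-prime 1≤w _ c _ X _ (m , _ , t<[2c-1]m , k , cmφ≤k , cell , cell-inj , occupied) a s ua s<t =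
  ratio-meets-cell X ua few-cells cell cell-inj occupied
  where
  open Cells p w p-prime 1≤w
  instance
    φN≢0 : NonZero (φ N)
    φN≢0 = nonZeroIndex (unitIndex ua)
  few-cells : φ N ℕ.* (s ℕ.+ m) ℕ.< k ℕ.+ k
  few-cells = f*[s+m]<k+k c (φ N) m t s k t<[2c-1]m cmφ≤k (<⇒≤ s<t)
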